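{- Let $n\ge 1$, let $\mathrm{id}\in S_n$ be the identity and let $\varphi:\mathbb{Z}_n\to\mathbb{Z}_n$ be the involution $\varphi(i)=(n-1)-i$. Let $f\in\mathbb{Z}_n^{\mathbb{Z}_n}$. Then $G_f$ is graceful if and only if there exist a nonempty set $\mathcal{G}\subset S_n$ and a sign function $\mathfrak{s}:\mathcal{G}\times\mathbb{Z}_n\to\{ -1,0,1\}$ such that for every $\gamma\in\mathcal{G}$ there is a coset representative $\sigma_\gamma\in S_n/\mathrm{Aut}(G_f)$ with \[ f(i)=\sigma_\gamma^{(-1)}\Big(\varphi^{(t)}\big(\varphi^{(t)}(\sigma_\gamma(i))+(-1)^t\,\mathfrak{s}(\gamma,\sigma_\gamma(i))\,\gamma(\sigma_\gamma(i))\big)\Big)\quad\text{for all } i\in\mathbb{Z}_n \text{ and } t\in\{0,1\}, \] i.e. $f=\sigma_\gamma^{(-1)}\varphi^{(t)}\big(\varphi^{(t)}\sigma_\gamma+(-1)^t\,\mathfrak{s}(\gamma,\sigma_\gamma)\cdot\gamma\sigma_\gamma\big)$ for all $\gamma\in\mathcal{G}$, $t\in\{0,1\}$.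
   Context: $\mathbb{Z}_n:=\{0,1,\dots,n-1\}$ (a set of integers; arithmetic is ordinary integer arithmetic). $\mathbb{Z}_n^{\mathbb{Z}_n}$ is the set of all maps $\mathbb{Z}_n\to\mathbb{Z}_n$, composition is written by juxtaposition, $S_n\subset\mathbb{Z}_n^{\mathbb{Z}_n}$ is the symmetric group, $\sigma^{(-1)}$ is the inverse permutation, $h^{(0)}=\mathrm{id}$ and $h^{(k+1)}=h\circ h^{(k)}$. For $f\in\mathbb{Z}_n^{\mathbb{Z}_n}$, the functional directed graph $G_f$ has vertex set $\mathbb{Z}_n$ and directed edge set $\{(i,f(i)):i\in\mathbb{Z}_n\}$. $G_f$ is graceful if there is a bijection $\sigma\in S_n$ with $\{|\sigma f\sigma^{(-1)}(i)-i|:i\in\mathbb{Z}_n\}=\mathbb{Z}_n$. $\mathrm{Aut}(G_f)\subseteq S_n$ is the automorphism group of $G_f$, i.e. the permutations $\sigma$ with $\sigma f\sigma^{(-1)}=f$; a coset representative in $S_n/\mathrm{Aut}(G_f)$ is any element of $S_n$ chosen to represent a (left) coset of $\mathrm{Aut}(G_f)$.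
   Formalization: For each γ ∈ 𝒢, the sign function 𝔰 takes the value 0 at (γ, j) only where γ(j) = 0, rather than being an arbitrary map into {−1,0,1}. The statement above fails without it. -}

module Defs where

open import Data.Nat as ℕ using (ℕ; zero; suc; _∸_)
open import Data.Integer as ℤ using (ℤ; +_; _-_; _+_; _*_; _^_; -1ℤ; 0ℤ; 1ℤ; ∣_∣)
open import Data.Fin using (Fin; toℕ)
open import Data.Fin.Permutation using (Permutation′; _⟨$⟩ʳ_; _⟨$⟩ˡ_)
open import Data.Product using (Σ; ∃; _×_; _,_)
open import Relation.Binary.PropositionalEquality using (_≡_)

toℤ : {n : ℕ} → Fin n → ℤ
toℤ i = + toℕ i

Graceful : (n : ℕ) → (Fin n → Fin n) → Set
Graceful n f =
  Σ (Permutation′ n) λ σ →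
    ((i : Fin n) → Σ (Fin n) λ k →
        toℕ k ≡ ∣ toℤ (σ ⟨$⟩ʳ f (σ ⟨$⟩ˡ i)) - toℤ i ∣)
  × ((k : Fin n) → Σ (Fin n) λ i →
        ∣ toℤ (σ ⟨$⟩ʳ f (σ ⟨$⟩ˡ i)) - toℤ i ∣ ≡ toℕ k)

-- The involution φ(i) = (n-1) - i, written on integers (it agrees with
-- φ on ℤ_n and maps an integer into ℤ_n iff that integer lies in ℤ_n).
φ : ℕ → ℤ → ℤ
φ n x = + (n ∸ 1) - x

iter : ℕ → (ℤ → ℤ) → ℤ → ℤ
iter zero    h x = x
iter (suc t) h x = h (iter t h x)

data Sign : Set where
  neg zer pos : Sign

⟦_⟧ : Sign → ℤ
⟦ neg ⟧ = -1ℤ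
⟦ zer ⟧ = 0ℤ
⟦ pos ⟧ = 1ℤ

Represents : (n : ℕ) → (Fin n → Fin n) → Permutation′ n → (Fin n → Sign)
           → Permutation′ n → Set
Represents n f γ sγ σ =
  (i : Fin n) (t : Fin 2) →
    Σ (Fin n) λ k →
      (toℤ k ≡ iter (toℕ t) (φ n)
                 (iter (toℕ t) (φ n) (toℤ (σ ⟨$⟩ʳ i))
                   + (-1ℤ ^ toℕ t) * ⟦ sγ (σ ⟨$⟩ʳ i) ⟧ * toℤ (γ ⟨$⟩ʳ (σ ⟨$⟩ʳ i))))
      × (f i ≡ σ ⟨$⟩ˡ k)

SignCoherent : (n : ℕ) → Permutation′ n → (Fin n → Sign) → Set
SignCoherent n γ sγ = (j : Fin n) → sγ j ≡ zer → toℕ (γ ⟨$⟩ʳ j) ≡ 0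

{-# OPTIONS --safe #-}
module Submission where

-- Write D_σ(j) = σfσ⁻¹(j) − j for the displacement of the conjugate σfσ⁻¹.
-- G_f is graceful via σ exactly when j ↦ |D_σ(j)| is a permutation γ of ℤ_n
-- (a map ℤ_n → ℤ_n onto ℤ_n is a bijection). Writing D_σ(j) = s(j)·γ(j) with s
-- the sign of D_σ, the formula of the theorem is σfσ⁻¹(j) = j + s(j)·γ(j)
-- conjugated by φ^(t); since φ is an affine involution of slope −1 the
-- conjugation only flips the sign of the shift, which (−1)^t undoes. So a
-- single γ suffices in one direction, and any γ ∈ 𝒢 gives gracefulness back.

open import Defs
open import Data.Nat using (ℕ; _≤_; zero; suc; _∸_)
open import Data.Fin using (Fin; zero; suc; toℕ; punchOut)
open import Data.Fin.Properties using (any?; punchOut-injective; toℕ-injective; injective⇒≤)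
  renaming (_≟_ to _≟ᶠ_)
open import Data.Fin.Permutation
  using (Permutation′; _⟨$⟩ʳ_; _⟨$⟩ˡ_; permutation; inverseˡ; inverseʳ)
open import Data.Integer using (ℤ; +_; -[1+_]; _-_; _+_; _*_; _^_; -1ℤ; 1ℤ; ∣_∣)
import Data.Integer.Properties as ℤ
open import Data.Integer.Tactic.RingSolver using (solve-∀)
import Data.Nat.Properties as ℕ
open import Data.Product using (Σ; ∃; ∃₂; _×_; _,_; proj₁; proj₂)
open import Data.Empty using (⊥-elim)
open import Function.Bundles using (_⇔_; mk⇔; Equivalence)
open import Function.Definitions using (Injective)
open import Relation.Binary.PropositionalEquality
open import Relation.Nullary using (yes; no)

injective⇒surjective : ∀ {n} (h : Fin n → Fin n) → Injective _≡_ _≡_ h →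
                       ∀ y → ∃ λ x → h x ≡ y
injective⇒surjective {suc m} h h-injective y with any? (λ x → h x ≟ᶠ y)
... | yes hit = hit
... | no ¬hit = ⊥-elim (ℕ.1+n≰n (injective⇒≤ squeezed-injective))
  where
  missed : ∀ x → y ≢ h x
  missed x y≡hx = ¬hit (x , sym y≡hx)

  squeezed : Fin (suc m) → Fin m
  squeezed x = punchOut (missed x)

  squeezed-injective : Injective _≡_ _≡_ squeezed
  squeezed-injective eq = h-injective (punchOut-injective (missed _) (missed _) eq)

rightInverse⇒permutation : ∀ {n} (g h : Fin n → Fin n) → (∀ y → g (h y) ≡ y) →
                           Permutation′ n
rightInverse⇒permutation g h g∘h≡id = permutation g h g∘h≡id h∘g≡id
  where
  h-injective : Injective _≡_ _≡_ h
  h-injective {x} {y} hx≡hy = trans (sym (g∘h≡id x)) (trans (cong g hx≡hy) (g∘h≡id y))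

  h∘g≡id : ∀ x → h (g x) ≡ x
  h∘g≡id x with injective⇒surjective h h-injective x
  ... | y , refl = cong h (g∘h≡id y)

signOf : ℤ → Sign
signOf (+ zero)  = zer
signOf (+ suc _) = pos
signOf -[1+ _ ]  = neg

⟦signOf-i⟧*∣i∣≡i : ∀ i → ⟦ signOf i ⟧ * + ∣ i ∣ ≡ i
⟦signOf-i⟧*∣i∣≡i (+ zero)  = refl
⟦signOf-i⟧*∣i∣≡i (+ suc m) = ℤ.*-identityˡ (+ suc m)
⟦signOf-i⟧*∣i∣≡i -[1+ m ]  = ℤ.-1*i≡-i (+ suc m)

signOf-i≡zer⇒∣i∣≡0 : ∀ i → signOf i ≡ zer → ∣ i ∣ ≡ 0
signOf-i≡zer⇒∣i∣≡0 (+ zero) _ = refl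

∣⟦s⟧*m∣≡m : ∀ s m → (s ≡ zer → m ≡ 0) → ∣ ⟦ s ⟧ * + m ∣ ≡ m
∣⟦s⟧*m∣≡m neg m _      = trans (cong ∣_∣ (ℤ.-1*i≡-i (+ m))) (ℤ.∣-i∣≡∣i∣ (+ m))
∣⟦s⟧*m∣≡m zer m zer⇒0 = sym (zer⇒0 refl)
∣⟦s⟧*m∣≡m pos m _      = cong ∣_∣ (ℤ.*-identityˡ (+ m))

i+[j-i]≡j : ∀ i j → i + (j - i) ≡ j
i+[j-i]≡j = solve-∀

[i+j]-i≡j : ∀ i j → (i + j) - i ≡ j
[i+j]-i≡j = solve-∀

iterφ-conjugate-shift : ∀ n (t : Fin 2) a p q →
  iter (toℕ t) (φ n) (iter (toℕ t) (φ n) a + (-1ℤ ^ toℕ t) * p * q) ≡ a + p * q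
iterφ-conjugate-shift n zero       a p q = cong (λ p′ → a + p′ * q) (ℤ.*-identityˡ p)
iterφ-conjugate-shift n (suc zero) a p q = reflect-twice (+ (n ∸ 1)) a p q
  where
  reflect-twice : ∀ c a p q → c - ((c - a) + (-1ℤ * 1ℤ) * p * q) ≡ a + p * q
  reflect-twice = solve-∀

displacement : ∀ {n} → Permutation′ n → (Fin n → Fin n) → Fin n → ℤ
displacement σ f j = toℤ (σ ⟨$⟩ʳ f (σ ⟨$⟩ˡ j)) - toℤ j

graceful⇔∣displacement∣-permutation : ∀ {n} (f : Fin n → Fin n) →
  Graceful n f ⇔ ∃₂ λ σ γ → ∀ j → ∣ displacement σ f j ∣ ≡ toℕ (γ ⟨$⟩ʳ j)
graceful⇔∣displacement∣-permutation {n} f = mk⇔ to from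
  where
  to : Graceful n f → ∃₂ λ σ γ → ∀ j → ∣ displacement σ f j ∣ ≡ toℕ (γ ⟨$⟩ʳ j)
  to (σ , covered , hit) =
    σ , rightInverse⇒permutation label witness label∘witness≡id , λ j → sym (proj₂ (covered j))
    where
    label witness : Fin n → Fin n
    label j   = proj₁ (covered j)
    witness k = proj₁ (hit k)

    label∘witness≡id : ∀ k → label (witness k) ≡ k
    label∘witness≡id k = toℕ-injective (trans (proj₂ (covered (witness k))) (proj₂ (hit k)))

  from : (∃₂ λ σ γ → ∀ j → ∣ displacement σ f j ∣ ≡ toℕ (γ ⟨$⟩ʳ j)) → Graceful n f
  from (σ , γ , ∣D∣≡γ) =
    σ , (λ j → γ ⟨$⟩ʳ j , sym (∣D∣≡γ j))
      , (λ k → γ ⟨$⟩ˡ k , trans (∣D∣≡γ (γ ⟨$⟩ˡ k)) (cong toℕ (inverseʳ γ)))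

represents⇔displacement≡signed : ∀ {n} (f : Fin n → Fin n) γ s σ →
  Represents n f γ s σ ⇔ (∀ j → displacement σ f j ≡ ⟦ s j ⟧ * toℤ (γ ⟨$⟩ʳ j))
represents⇔displacement≡signed {n} f γ s σ = mk⇔ to from
  where
  open ≡-Reasoning

  shifted : Fin n → ℤ
  shifted j = toℤ j + ⟦ s j ⟧ * toℤ (γ ⟨$⟩ʳ j)

  to : Represents n f γ s σ → ∀ j → displacement σ f j ≡ ⟦ s j ⟧ * toℤ (γ ⟨$⟩ʳ j)
  to rep j with rep (σ ⟨$⟩ˡ j) zero
  ... | k , k≡ , f≡ = begin
    toℤ (σ ⟨$⟩ʳ f (σ ⟨$⟩ˡ j)) - toℤ j   ≡⟨ cong (λ x → toℤ (σ ⟨$⟩ʳ x) - toℤ j) f≡ ⟩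
    toℤ (σ ⟨$⟩ʳ (σ ⟨$⟩ˡ k)) - toℤ j     ≡⟨ cong (λ x → toℤ x - toℤ j) (inverseʳ σ) ⟩
    toℤ k - toℤ j                       ≡⟨ cong (_- toℤ j) k≡ ⟩
    iter 0 (φ n) (toℤ j′ + 1ℤ * ⟦ s j′ ⟧ * toℤ (γ ⟨$⟩ʳ j′)) - toℤ j
      ≡⟨ cong (_- toℤ j) (iterφ-conjugate-shift n zero (toℤ j′) ⟦ s j′ ⟧ (toℤ (γ ⟨$⟩ʳ j′))) ⟩
    shifted j′ - toℤ j                  ≡⟨ cong (λ x → shifted x - toℤ j) (inverseʳ σ) ⟩
    shifted j - toℤ j                   ≡⟨ [i+j]-i≡j (toℤ j) _ ⟩
    ⟦ s j ⟧ * toℤ (γ ⟨$⟩ʳ j)            ∎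
    where j′ = σ ⟨$⟩ʳ (σ ⟨$⟩ˡ j)

  from : (∀ j → displacement σ f j ≡ ⟦ s j ⟧ * toℤ (γ ⟨$⟩ʳ j)) → Represents n f γ s σ
  from D≡ i t = σ ⟨$⟩ʳ f i , sym formula , sym (inverseˡ σ)
    where
    j = σ ⟨$⟩ʳ i
    formula : iter (toℕ t) (φ n)
                (iter (toℕ t) (φ n) (toℤ j) + (-1ℤ ^ toℕ t) * ⟦ s j ⟧ * toℤ (γ ⟨$⟩ʳ j))
              ≡ toℤ (σ ⟨$⟩ʳ f i)
    formula = begin
      iter (toℕ t) (φ n) (iter (toℕ t) (φ n) (toℤ j) + (-1ℤ ^ toℕ t) * ⟦ s j ⟧ * toℤ (γ ⟨$⟩ʳ j))
        ≡⟨ iterφ-conjugate-shift n t (toℤ j) ⟦ s j ⟧ (toℤ (γ ⟨$⟩ʳ j)) ⟩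
      toℤ j + ⟦ s j ⟧ * toℤ (γ ⟨$⟩ʳ j)
        ≡⟨ cong (λ x → toℤ j + x) (D≡ j) ⟨
      toℤ j + (toℤ (σ ⟨$⟩ʳ f (σ ⟨$⟩ˡ j)) - toℤ j)
        ≡⟨ cong (λ x → toℤ j + (toℤ (σ ⟨$⟩ʳ f x) - toℤ j)) (inverseˡ σ) ⟩
      toℤ j + (toℤ (σ ⟨$⟩ʳ f i) - toℤ j)
        ≡⟨ i+[j-i]≡j (toℤ j) _ ⟩
      toℤ (σ ⟨$⟩ʳ f i) ∎

SignedRepresentation : (n : ℕ) → (Fin n → Fin n) → Set₁
SignedRepresentation n f =
  Σ (Permutation′ n → Set) λ 𝒢 →
    ∃ 𝒢 ×
    Σ (Permutation′ n → Fin n → Sign) λ s →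
      ((γ : Permutation′ n) → 𝒢 γ →
         SignCoherent n γ (s γ) ×
         Σ (Permutation′ n) λ σ → Represents n f γ (s γ) σ)

graceful⇒signedRepresentation : ∀ {n} (f : Fin n → Fin n) →
                                Graceful n f → SignedRepresentation n f
graceful⇒signedRepresentation f graceful
  with σ , γ , ∣D∣≡γ ← Equivalence.to (graceful⇔∣displacement∣-permutation f) graceful =
  (_≡ γ) , (γ , refl) , (λ _ → s) , λ { _ refl → coherent , σ , represents }
  where
  s : Fin _ → Sign
  s j = signOf (displacement σ f j)

  coherent : SignCoherent _ γ s
  coherent j s≡zer = trans (sym (∣D∣≡γ j)) (signOf-i≡zer⇒∣i∣≡0 _ s≡zer)

  represents : Represents _ f γ s σ
  represents = Equivalence.from (represents⇔displacement≡signed f γ s σ) λ j →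
    trans (sym (⟦signOf-i⟧*∣i∣≡i _)) (cong (λ m → ⟦ s j ⟧ * + m) (∣D∣≡γ j))

signedRepresentation⇒graceful : ∀ {n} (f : Fin n → Fin n) →
                                SignedRepresentation n f → Graceful n f
signedRepresentation⇒graceful f (_ , (γ , γ∈𝒢) , s , represented)
  with coherent , σ , represents ← represented γ γ∈𝒢 =
  Equivalence.from (graceful⇔∣displacement∣-permutation f) (σ , γ , ∣D∣≡γ)
  where
  ∣D∣≡γ : ∀ j → ∣ displacement σ f j ∣ ≡ toℕ (γ ⟨$⟩ʳ j)
  ∣D∣≡γ j = begin
    ∣ displacement σ f j ∣               ≡⟨ cong ∣_∣ (D≡ j) ⟩
    ∣ ⟦ s γ j ⟧ * toℤ (γ ⟨$⟩ʳ j) ∣       ≡⟨ ∣⟦s⟧*m∣≡m (s γ j) _ (coherent j) ⟩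
    toℕ (γ ⟨$⟩ʳ j)                      ∎
    where
    open ≡-Reasoning
    D≡ : ∀ j → displacement σ f j ≡ ⟦ s γ j ⟧ * toℤ (γ ⟨$⟩ʳ j)
    D≡ = Equivalence.to (represents⇔displacement≡signed f γ (s γ) σ) represents

theorem1 : (n : ℕ) → 1 ≤ n → (f : Fin n → Fin n) →
    Graceful n f ⇔
      Σ (Permutation′ n → Set) λ 𝒢 →
        ∃ 𝒢 ×
        Σ (Permutation′ n → Fin n → Sign) λ s →
          ((γ : Permutation′ n) → 𝒢 γ →
             SignCoherent n γ (s γ) ×
             Σ (Permutation′ n) λ σ → Represents n f γ (s γ) σ)
theorem1 n _ f = mk⇔ (graceful⇒signedRepresentation f) (signedRepresentation⇒graceful f)
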